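{- The overall running time of EdgePush with source $s$ and thresholds $\theta(u,v)>0$ is bounded by $$O\!\left(\sum_{\langle u,v\rangle\in\bar E}\frac{(1-\alpha)\,\boldsymbol\pi_s(u)\,\mathbf A_{uv}}{\alpha\, d(u)\,\theta(u,v)}\right).$$ In particular, when $s$ is chosen at random according to the degree distribution ($\Pr[s=u]=d(u)/\|\mathbf A\|_1$), the expected overall running time is bounded by $$O\!\left(\sum_{\langle u,v\rangle\in\bar E}\frac{(1-\alpha)\,\mathbf A_{uv}}{\alpha\,\|\mathbf A\|_1\,\theta(u,v)}\right).$$
   Context: $G=(V,E)$ is an undirected graph with $m$ edges and symmetric non-negative weighted adjacency matrix $\mathbf A$; $\bar E$ contains both directed edges $\langle u,v\rangle,\langle v,u\rangle$ of each $\{u,v\}\in E$; $N(u)$ is the neighbor set of $u$, $d(u)=\sum_{v\in N(u)}\mathbf A_{uv}>0$, $\|\mathbf A\|_1=\sum_{\langle u,v\rangle\in\bar E}\mathbf A_{uv}$, $\mathbf D=\mathrm{diag}(d(u))$, $\mathbf P=\mathbf A\mathbf D^{ -1}$. Fix $\alpha\in(0,1)$. For a node $x$, $\boldsymbol\pi_x=\alpha(\mathbf I-(1-\alpha)\mathbf P)^{ -1}\mathbf e_x$ is the Personalized PageRank vector with source $x$. EdgePush: given thresholds $\theta(u,v)>0$ for $\langle u,v\rangle\in\bar E$, it maintains a node income vector $\mathbf q$ and edge expenses $\mathbf{Q}_{uv}$, initialized $\mathbf q=\mathbf e_s$, $\mathbf Q=\mathbf 0$. The edge residue is $\mathbf R_{uv}=(1-\alpha)\mathbf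 q(u)\mathbf A_{uv}/d(u)-\mathbf Q_{uv}$. While some $\langle u,v\rangle\in\bar E$ has $\mathbf R_{uv}\ge\theta(u,v)$, it picks an arbitrary such edge, sets $y=\mathbf R_{uv}$ and performs an edge-based push $\mathbf Q_{uv}\leftarrow\mathbf Q_{uv}+y$, $\mathbf q(v)\leftarrow\mathbf q(v)+y$. On termination it outputs $\alpha\mathbf q$. Running time is that of an implementation in which each edge-based push (including locating an eligible edge and all bookkeeping) costs $O(1)$ amortized time, excluding an $O(m)$ preprocessing of the graph.
   Formalization: The edge weights $\mathbf A_{uv}$ are rational rather than real, and so are the parameter α and the thresholds θ(u,v). -}

module Defs where

open import Data.Nat using (ℕ; zero; suc)
open import Data.Fin using (Fin; zero; suc)
open import Data.Fin.Properties using () renaming (_≟_ to _≟ᶠ_)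
open import Relation.Binary.PropositionalEquality using (_≡_)
open import Data.Integer using (+_)
open import Data.Rational
  using (ℚ; 0ℚ; 1ℚ; _+_; _*_; _-_; _≤_; _<_; _÷_; ≢-nonZero)
open import Data.Rational.Properties using (_≟_; _<?_)
open import Data.Bool using (Bool; true; false; if_then_else_)
open import Relation.Nullary using (yes; no)
open import Relation.Nullary.Decidable using (⌊_⌋)
open import Data.Product using (Σ; _×_; _,_)

ℕ→ℚ : ℕ → ℚ
ℕ→ℚ k = Data.Rational._/_ (+ k) 1

-- total division (p ÷ 0 := 0); only used with positive denominators
_÷ᵗ_ : ℚ → ℚ → ℚ
p ÷ᵗ q with q ≟ 0ℚ
... | yes _  = 0ℚ
... | no q≢0 = _÷_ p q {{≢-nonZero q≢0}}

Σ[_] : (n : ℕ) → (Fin n → ℚ) → ℚ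
Σ[ zero  ] f = 0ℚ
Σ[ suc n ] f = f zero + Σ[ n ] (λ i → f (suc i))

-- weighted graph on node set Fin n given by its adjacency matrix
Matrix : ℕ → Set
Matrix n = Fin n → Fin n → ℚ

_∈Ē_ : ∀ {n} → Fin n × Fin n → Matrix n → Set
(u , v) ∈Ē A = 0ℚ < A u v

ΣĒ : ∀ {n} → Matrix n → (Fin n → Fin n → ℚ) → ℚ
ΣĒ {n} A f = Σ[ n ] (λ u → Σ[ n ] (λ v →
  if ⌊ 0ℚ <? A u v ⌋ then f u v else 0ℚ))

deg : ∀ {n} → Matrix n → Fin n → ℚ
deg {n} A u = Σ[ n ] (λ v → A u v)

norm1 : ∀ {n} → Matrix n → ℚ
norm1 {n} A = Σ[ n ] (λ u → deg A u)

record ValidGraph {n : ℕ} (A : Matrix n) : Set where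
  field
    symm   : ∀ u v → A u v ≡ A v u
    nonneg : ∀ u v → 0ℚ ≤ A u v
    degpos : ∀ u → 0ℚ < deg A u

𝟙[_≡_] : ∀ {n} → Fin n → Fin n → ℚ
𝟙[ s ≡ u ] = if ⌊ s ≟ᶠ u ⌋ then 1ℚ else 0ℚ

-- π is the PPR vector with source s: π = α (I - (1-α) A D⁻¹)⁻¹ e_s,
-- i.e. π is the (unique) solution of (I - (1-α) A D⁻¹) π = α e_s
IsPPR : ∀ {n} → Matrix n → ℚ → Fin n → (Fin n → ℚ) → Set
IsPPR {n} A α s π = ∀ u →
  π u - (1ℚ - α) * Σ[ n ] (λ v → (A u v ÷ᵗ deg A v) * π v)
    ≡ α * 𝟙[ s ≡ u ]

-- EdgePush state: node incomes q and edge expenses Q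
record State (n : ℕ) : Set where
  constructor ⟨_,_⟩
  field
    q : Fin n → ℚ
    Q : Matrix n
open State public

initState : ∀ {n} → Fin n → State n
initState s = ⟨ (λ u → 𝟙[ s ≡ u ]) , (λ _ _ → 0ℚ) ⟩

residue : ∀ {n} → Matrix n → ℚ → State n → Fin n → Fin n → ℚ
residue A α st u v = ((1ℚ - α) * q st u * A u v) ÷ᵗ deg A u - Q st u v

push : ∀ {n} → Matrix n → ℚ → State n → Fin n → Fin n → State n
push A α st u v =
  ⟨ (λ w → if ⌊ w ≟ᶠ v ⌋ then q st w + y else q st w)
  , (λ a b → if ⌊ a ≟ᶠ u ⌋ ∧ ⌊ b ≟ᶠ v ⌋ then Q st a b + y else Q st a b) ⟩
  where
    y = residue A α st u v
    _∧_ : Bool → Bool → Bool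
    true ∧ b = b
    false ∧ _ = false

data Step {n : ℕ} (A : Matrix n) (α : ℚ) (θ : Matrix n) : State n → State n → Set where
  step : ∀ st u v → (u , v) ∈Ē A → θ u v ≤ residue A α st u v →
         Step A α θ st (push A α st u v)

data Run {n : ℕ} (A : Matrix n) (α : ℚ) (θ : Matrix n) (s : Fin n) : ℕ → State n → Set where
  start : Run A α θ s 0 (initState s)
  next  : ∀ {k st st'} → Run A α θ s k st → Step A α θ st st' → Run A α θ s (suc k) st'

module Submission where

-- Every push moves at least θ(u,v) into the expense Q(u,v), so the number of pushes is at
-- most Σ Q(u,v)/θ(u,v).  Throughout the run the residues stay non-negative and q is e_s plus
-- the incoming expenses; by symmetry of A this gives 𝓛(π_s - α q) ≥ 0 for 𝓛 = I - (1-α)P,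
-- and a minimum principle for 𝓛 (inspect a minimiser of x/d) turns it into α q ≤ π_s.
-- Hence Q(u,v) ≤ (1-α) q(u) A_uv / d(u) ≤ (1-α) π_s(u) A_uv / (α d(u)).  For a source drawn
-- with probability d(s)/‖A‖₁, the same minimum principle gives Σ_s d(s) π_s(u) ≤ d(u), which
-- collapses the averaged bound to the second sum.

open import Defs
open import Data.Nat using (ℕ; zero; suc)
open import Data.Fin using (Fin; zero; suc)
open import Data.Fin.Properties using (suc-injective) renaming (_≟_ to _≟ᶠ_)
import Data.Integer as ℤ
import Data.Integer.Properties as ℤ
import Data.Nat.Coprimality as Coprimality
open import Data.Rational
  using (ℚ; 0ℚ; 1ℚ; _+_; _*_; _-_; -_; 1/_; _≤_; _<_; mkℚ; ≢-nonZero; nonNegative; positive)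
open import Data.Rational.Properties
open import Data.Product using (Σ; ∃; _×_; _,_; proj₂)
open import Data.Sum using (_⊎_; inj₁; inj₂)
open import Data.Bool using (if_then_else_)
open import Data.Empty using (⊥-elim)
open import Data.List using (allFin)
open import Data.List.Membership.Propositional.Properties using (∈-allFin)
import Data.List.Relation.Unary.All as All
open import Function using (_∘_)
open import Relation.Binary.Bundles using (DecTotalOrder)
open import Data.List.Extrema (DecTotalOrder.totalOrder ≤-decTotalOrder)
  using (argmin; f[argmin]≤f[xs])
open import Relation.Binary.PropositionalEquality
  using (_≡_; _≢_; refl; sym; trans; cong; cong₂; subst; subst₂; ≢-sym; module ≡-Reasoning)
open import Relation.Nullary using (Dec; yes; no)
open import Relation.Nullary.Decidable using (⌊_⌋; dec⇒maybe)
open import Tactic.RingSolver using (solve-∀)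
open import Tactic.RingSolver.Core.AlmostCommutativeRing
  using (AlmostCommutativeRing; fromCommutativeRing)

ℚ-ring : AlmostCommutativeRing _ _
ℚ-ring = fromCommutativeRing +-*-commutativeRing (λ p → dec⇒maybe (0ℚ ≟ p))

x*yz≡y*xz : ∀ p q r → p * (q * r) ≡ q * (p * r)
x*yz≡y*xz = solve-∀ ℚ-ring

p≤q⇒0≤q-p : ∀ {p q} → p ≤ q → 0ℚ ≤ q - p
p≤q⇒0≤q-p {p} {q} p≤q = subst (_≤ q - p) (+-inverseʳ p) (+-monoˡ-≤ (- p) p≤q)

0≤q-p⇒p≤q : ∀ {p q} → 0ℚ ≤ q - p → p ≤ q
0≤q-p⇒p≤q {p} {q} 0≤q-p = subst₂ _≤_ (+-identityˡ p) (q-p+p≡q p q) (+-monoˡ-≤ p 0≤q-p)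
  where
  q-p+p≡q : ∀ p q → q - p + p ≡ q
  q-p+p≡q = solve-∀ ℚ-ring

*-nonNeg : ∀ {p q} → 0ℚ ≤ p → 0ℚ ≤ q → 0ℚ ≤ p * q
*-nonNeg {p} {q} 0≤p 0≤q =
  nonNegative⁻¹ _ {{nonNeg*nonNeg⇒nonNeg p {{nonNegative 0≤p}} q {{nonNegative 0≤q}}}}

*-pos : ∀ {p q} → 0ℚ < p → 0ℚ < q → 0ℚ < p * q
*-pos {p} {q} 0<p 0<q = positive⁻¹ _ {{pos*pos⇒pos p {{positive 0<p}} q {{positive 0<q}}}}

*-monoˡ-≤-nonNeg′ : ∀ {r p q} → 0ℚ ≤ r → p ≤ q → r * p ≤ r * q
*-monoˡ-≤-nonNeg′ {r} 0≤r = *-monoˡ-≤-nonNeg r {{nonNegative 0≤r}}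

*-monoʳ-≤-nonNeg′ : ∀ {r p q} → 0ℚ ≤ r → p ≤ q → p * r ≤ q * r
*-monoʳ-≤-nonNeg′ {r} 0≤r = *-monoʳ-≤-nonNeg r {{nonNegative 0≤r}}

0<p⇒p≢0 : ∀ {p} → 0ℚ < p → p ≢ 0ℚ
0<p⇒p≢0 0<p = ≢-sym (<⇒≢ 0<p)

0≤1/p : ∀ {p} (p≢0 : p ≢ 0ℚ) → 0ℚ ≤ p → 0ℚ ≤ (1/ p) {{≢-nonZero p≢0}}
0≤1/p {p} p≢0 0≤p = <⇒≤ (positive⁻¹ _ {{1/pos⇒pos p {{0<p}}}})
  where
  0<p = nonNeg∧nonZero⇒pos p {{nonNegative 0≤p}} {{≢-nonZero p≢0}}

*-÷ᵗ-assoc : ∀ p q r → (p * q) ÷ᵗ r ≡ p * (q ÷ᵗ r)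
*-÷ᵗ-assoc p q r with r ≟ 0ℚ
... | yes _ = sym (*-zeroʳ p)
... | no _  = *-assoc p q _

÷ᵗ-distribʳ-+ : ∀ p q r → (p + q) ÷ᵗ r ≡ p ÷ᵗ r + q ÷ᵗ r
÷ᵗ-distribʳ-+ p q r with r ≟ 0ℚ
... | yes _ = sym (+-identityˡ 0ℚ)
... | no _  = *-distribʳ-+ _ p q

÷ᵗ-*≡*-÷ᵗ : ∀ p q r → (p ÷ᵗ r) * q ≡ p * (q ÷ᵗ r)
÷ᵗ-*≡*-÷ᵗ p q r = begin
  (p ÷ᵗ r) * q   ≡⟨ *-comm (p ÷ᵗ r) q ⟩
  q * (p ÷ᵗ r)   ≡⟨ *-÷ᵗ-assoc q p r ⟨
  (q * p) ÷ᵗ r   ≡⟨ cong (_÷ᵗ r) (*-comm q p) ⟩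
  (p * q) ÷ᵗ r   ≡⟨ *-÷ᵗ-assoc p q r ⟩
  p * (q ÷ᵗ r)   ∎
  where open ≡-Reasoning

*-÷ᵗ-cancel : ∀ {r} p → r ≢ 0ℚ → r * (p ÷ᵗ r) ≡ p
*-÷ᵗ-cancel {r} p r≢0 with r ≟ 0ℚ
... | yes r≡0 = ⊥-elim (r≢0 r≡0)
... | no _    = begin
  r * (p * 1/ r)  ≡⟨ cong (r *_) (*-comm p _) ⟩
  r * (1/ r * p)  ≡⟨ *-assoc r _ p ⟨
  r * 1/ r * p    ≡⟨ cong (_* p) (*-inverseʳ r) ⟩
  1ℚ * p          ≡⟨ *-identityˡ p ⟩
  p               ∎
  where
  open ≡-Reasoning
  instance _ = ≢-nonZero r≢0

÷ᵗ-monoˡ-≤ : ∀ {r p q} → 0ℚ ≤ r → p ≤ q → p ÷ᵗ r ≤ q ÷ᵗ r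
÷ᵗ-monoˡ-≤ {r} 0≤r p≤q with r ≟ 0ℚ
... | yes _   = ≤-refl
... | no r≢0 = *-monoʳ-≤-nonNeg′ (0≤1/p r≢0 0≤r) p≤q

÷ᵗ-nonNeg : ∀ {p r} → 0ℚ ≤ p → 0ℚ ≤ r → 0ℚ ≤ p ÷ᵗ r
÷ᵗ-nonNeg {r = r} 0≤p 0≤r with r ≟ 0ℚ
... | yes _   = ≤-refl
... | no r≢0 = *-nonNeg 0≤p (0≤1/p r≢0 0≤r)

≤-÷ᵗ : ∀ {r p q} → 0ℚ < r → r * p ≤ q → p ≤ q ÷ᵗ r
≤-÷ᵗ {r} {p} {q} 0<r r*p≤q = subst (_≤ q ÷ᵗ r)
  (trans (*-÷ᵗ-assoc r p r) (*-÷ᵗ-cancel p (0<p⇒p≢0 0<r)))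
  (÷ᵗ-monoˡ-≤ (<⇒≤ 0<r) r*p≤q)

ℕ→ℚ-suc : ∀ k → ℕ→ℚ (suc k) ≡ ℕ→ℚ k + 1ℚ
ℕ→ℚ-suc k = begin
  ℕ→ℚ (suc k)              ≡⟨ cong (λ i → Data.Rational._/_ i 1) (sym k*1+1*1≡1+k) ⟩
  mkℚ (ℤ.+ k) 0 k⊥1 + 1ℚ   ≡⟨ cong (_+ 1ℚ) (normalize-coprime k⊥1) ⟨
  ℕ→ℚ k + 1ℚ               ∎
  where
  open ≡-Reasoning
  k⊥1 : Coprimality.Coprime k 1
  k⊥1 = Coprimality.sym (Coprimality.1-coprimeTo k)
  k*1+1*1≡1+k : ℤ.+ k ℤ.* ℤ.+ 1 ℤ.+ ℤ.+ 1 ℤ.* ℤ.+ 1 ≡ ℤ.+ suc k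
  k*1+1*1≡1+k = trans (cong (ℤ._+ ℤ.+ 1) (ℤ.*-identityʳ (ℤ.+ k))) (ℤ.+-comm (ℤ.+ k) (ℤ.+ 1))

𝟙-nonNeg : ∀ {n} (s u : Fin n) → 0ℚ ≤ 𝟙[ s ≡ u ]
𝟙-nonNeg s u with s ≟ᶠ u
... | yes _ = <⇒≤ (positive⁻¹ 1ℚ)
... | no _  = ≤-refl

Σ-cong : ∀ {n} {f g : Fin n → ℚ} → (∀ i → f i ≡ g i) → Σ[ n ] f ≡ Σ[ n ] g
Σ-cong {zero}  f≗g = refl
Σ-cong {suc n} f≗g = cong₂ _+_ (f≗g zero) (Σ-cong (f≗g ∘ suc))

Σ-mono-≤ : ∀ {n} {f g : Fin n → ℚ} → (∀ i → f i ≤ g i) → Σ[ n ] f ≤ Σ[ n ] g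
Σ-mono-≤ {zero}  f≤g = ≤-refl
Σ-mono-≤ {suc n} f≤g = +-mono-≤ (f≤g zero) (Σ-mono-≤ (f≤g ∘ suc))

Σ-0 : ∀ n → Σ[ n ] (λ _ → 0ℚ) ≡ 0ℚ
Σ-0 zero    = refl
Σ-0 (suc n) = cong (0ℚ +_) (Σ-0 n)

Σ-nonNeg : ∀ {n} {f : Fin n → ℚ} → (∀ i → 0ℚ ≤ f i) → 0ℚ ≤ Σ[ n ] f
Σ-nonNeg {n} {f} 0≤f = subst (_≤ Σ[ n ] f) (Σ-0 n) (Σ-mono-≤ 0≤f)

Σ-pos : ∀ {n} {f : Fin (suc n) → ℚ} → (∀ i → 0ℚ < f i) → 0ℚ < Σ[ suc n ] f
Σ-pos 0<f = +-mono-<-≤ (0<f zero) (Σ-nonNeg (<⇒≤ ∘ 0<f ∘ suc))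

Σ-distrib-+ : ∀ {n} (f g : Fin n → ℚ) → Σ[ n ] (λ i → f i + g i) ≡ Σ[ n ] f + Σ[ n ] g
Σ-distrib-+ {zero}  f g = refl
Σ-distrib-+ {suc n} f g = trans
  (cong ((f zero + g zero) +_) (Σ-distrib-+ (f ∘ suc) (g ∘ suc)))
  (interchange (f zero) (g zero) _ _)
  where
  interchange : ∀ a b c d → (a + b) + (c + d) ≡ (a + c) + (b + d)
  interchange = solve-∀ ℚ-ring

Σ-distrib-sub : ∀ {n} (f g : Fin n → ℚ) → Σ[ n ] (λ i → f i - g i) ≡ Σ[ n ] f - Σ[ n ] g
Σ-distrib-sub {zero}  f g = refl
Σ-distrib-sub {suc n} f g = trans
  (cong ((f zero - g zero) +_) (Σ-distrib-sub (f ∘ suc) (g ∘ suc)))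
  (interchange (f zero) (g zero) _ _)
  where
  interchange : ∀ a b c d → (a - b) + (c - d) ≡ (a + c) - (b + d)
  interchange = solve-∀ ℚ-ring

*-distribˡ-Σ : ∀ {n} c (f : Fin n → ℚ) → c * Σ[ n ] f ≡ Σ[ n ] (λ i → c * f i)
*-distribˡ-Σ {zero}  c f = *-zeroʳ c
*-distribˡ-Σ {suc n} c f =
  trans (*-distribˡ-+ c (f zero) _) (cong (c * f zero +_) (*-distribˡ-Σ c (f ∘ suc)))

Σ-comm : ∀ {m n} (f : Fin m → Fin n → ℚ) →
  Σ[ m ] (λ i → Σ[ n ] (f i)) ≡ Σ[ n ] (λ j → Σ[ m ] (λ i → f i j))
Σ-comm {zero}  {n} f = sym (Σ-0 n)
Σ-comm {suc m} {n} f = trans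
  (cong (Σ[ n ] (f zero) +_) (Σ-comm (f ∘ suc)))
  (sym (Σ-distrib-+ (f zero) (λ j → Σ[ m ] (λ i → f (suc i) j))))

Σ-update : ∀ {n} {f g : Fin n → ℚ} {c} j →
  (∀ i → i ≢ j → g i ≡ f i) → g j ≡ f j + c → Σ[ n ] g ≡ Σ[ n ] f + c
Σ-update {suc n} {f} {g} {c} zero elsewhere at-j = begin
  g zero + Σ[ n ] (g ∘ suc)         ≡⟨ cong₂ _+_ at-j (Σ-cong (λ i → elsewhere (suc i) λ ())) ⟩
  f zero + c + Σ[ n ] (f ∘ suc)     ≡⟨ +-assoc (f zero) c _ ⟩
  f zero + (c + Σ[ n ] (f ∘ suc))   ≡⟨ cong (f zero +_) (+-comm c _) ⟩
  f zero + (Σ[ n ] (f ∘ suc) + c)   ≡⟨ +-assoc (f zero) _ c ⟨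
  f zero + Σ[ n ] (f ∘ suc) + c     ∎
  where open ≡-Reasoning
Σ-update {suc n} {f} {g} {c} (suc j) elsewhere at-j = trans
  (cong₂ _+_ (elsewhere zero λ ())
    (Σ-update j (λ i i≢j → elsewhere (suc i) (i≢j ∘ suc-injective)) at-j))
  (sym (+-assoc (f zero) _ c))

Σ-indicator : ∀ {n} (f : Fin n → ℚ) u → Σ[ n ] (λ s → f s * 𝟙[ s ≡ u ]) ≡ f u
Σ-indicator {n} f u = begin
  Σ[ n ] (λ s → f s * 𝟙[ s ≡ u ])   ≡⟨ Σ-update u off-u at-u ⟩
  Σ[ n ] (λ _ → 0ℚ) + f u           ≡⟨ cong (_+ f u) (Σ-0 n) ⟩
  0ℚ + f u                          ≡⟨ +-identityˡ (f u) ⟩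
  f u                               ∎
  where
  open ≡-Reasoning
  off-u : ∀ s → s ≢ u → f s * 𝟙[ s ≡ u ] ≡ 0ℚ
  off-u s s≢u with s ≟ᶠ u
  ... | yes s≡u = ⊥-elim (s≢u s≡u)
  ... | no _    = *-zeroʳ (f s)
  at-u : f u * 𝟙[ u ≡ u ] ≡ 0ℚ + f u
  at-u with u ≟ᶠ u
  ... | yes _   = trans (*-identityʳ (f u)) (sym (+-identityˡ (f u)))
  ... | no u≢u = ⊥-elim (u≢u refl)

norm1-pos : ∀ {n} {A : Matrix n} → (∀ u → 0ℚ < deg A u) → Fin n → 0ℚ < norm1 A
norm1-pos {suc n} d>0 _ = Σ-pos d>0

module _ {n : ℕ} {A : Matrix n} where

  onĒ : (Fin n → Fin n → ℚ) → Fin n → Fin n → ℚ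
  onĒ f u v = if ⌊ 0ℚ <? A u v ⌋ then f u v else 0ℚ

  onĒ-edge : ∀ {f u v} → (u , v) ∈Ē A → onĒ f u v ≡ f u v
  onĒ-edge {f} {u} {v} uv∈Ē = on (0ℚ <? A u v)
    where
    on : (d : Dec (0ℚ < A u v)) → (if ⌊ d ⌋ then f u v else 0ℚ) ≡ f u v
    on (yes _)    = refl
    on (no uv∉Ē) = ⊥-elim (uv∉Ē uv∈Ē)

  onĒ-lift : ∀ (R : ℚ → ℚ → Set) f g u v → R 0ℚ 0ℚ →
    ((u , v) ∈Ē A → R (f u v) (g u v)) → R (onĒ f u v) (onĒ g u v)
  onĒ-lift R f g u v R00 Rfg = on (0ℚ <? A u v)
    where
    on : (d : Dec (0ℚ < A u v)) →
      R (if ⌊ d ⌋ then f u v else 0ℚ) (if ⌊ d ⌋ then g u v else 0ℚ)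
    on (yes uv∈Ē) = Rfg uv∈Ē
    on (no _)      = R00

  ΣĒ-mono-≤ : ∀ {f g} → (∀ u v → (u , v) ∈Ē A → f u v ≤ g u v) → ΣĒ A f ≤ ΣĒ A g
  ΣĒ-mono-≤ {f} {g} f≤g =
    Σ-mono-≤ λ u → Σ-mono-≤ λ v → onĒ-lift _≤_ f g u v ≤-refl (f≤g u v)

  ΣĒ-nonNeg : ∀ {f} → (∀ u v → (u , v) ∈Ē A → 0ℚ ≤ f u v) → 0ℚ ≤ ΣĒ A f
  ΣĒ-nonNeg {f} 0≤f =
    Σ-nonNeg λ u → Σ-nonNeg λ v → onĒ-lift (λ _ y → 0ℚ ≤ y) f f u v ≤-refl (0≤f u v)

  *-distribˡ-ΣĒ : ∀ c f → c * ΣĒ A f ≡ ΣĒ A (λ u v → c * f u v)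
  *-distribˡ-ΣĒ c f = begin
    c * ΣĒ A f                                    ≡⟨ *-distribˡ-Σ c (λ u → Σ[ n ] (onĒ f u)) ⟩
    Σ[ n ] (λ u → c * Σ[ n ] (onĒ f u))           ≡⟨ Σ-cong (λ u → *-distribˡ-Σ c (onĒ f u)) ⟩
    Σ[ n ] (λ u → Σ[ n ] (λ v → c * onĒ f u v))   ≡⟨ Σ-cong (λ u → Σ-cong (c*onĒ u)) ⟩
    ΣĒ A (λ u v → c * f u v)                      ∎
    where
    open ≡-Reasoning
    c*onĒ : ∀ u v → c * onĒ f u v ≡ onĒ (λ u v → c * f u v) u v
    c*onĒ u v = onĒ-lift (λ x y → c * x ≡ y) f (λ u v → c * f u v) u v (*-zeroʳ c) (λ _ → refl)

  Σ-ΣĒ-comm : ∀ {m} (f : Fin m → Fin n → Fin n → ℚ) →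
    Σ[ m ] (λ s → ΣĒ A (f s)) ≡ ΣĒ A (λ u v → Σ[ m ] (λ s → f s u v))
  Σ-ΣĒ-comm {m} f = begin
    Σ[ m ] (λ s → Σ[ n ] (λ u → Σ[ n ] (onĒ (f s) u)))
      ≡⟨ Σ-comm (λ s u → Σ[ n ] (onĒ (f s) u)) ⟩
    Σ[ n ] (λ u → Σ[ m ] (λ s → Σ[ n ] (onĒ (f s) u)))
      ≡⟨ Σ-cong (λ u → Σ-comm (λ s → onĒ (f s) u)) ⟩
    Σ[ n ] (λ u → Σ[ n ] (λ v → Σ[ m ] (λ s → onĒ (f s) u v)))
      ≡⟨ Σ-cong (λ u → Σ-cong (λ v → Σ-onĒ u v (0ℚ <? A u v))) ⟩
    ΣĒ A (λ u v → Σ[ m ] (λ s → f s u v))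
      ∎
    where
    open ≡-Reasoning
    Σ-onĒ : ∀ u v (d : Dec (0ℚ < A u v)) →
      Σ[ m ] (λ s → if ⌊ d ⌋ then f s u v else 0ℚ)
        ≡ (if ⌊ d ⌋ then Σ[ m ] (λ s → f s u v) else 0ℚ)
    Σ-onĒ u v (yes _) = refl
    Σ-onĒ u v (no _)  = Σ-0 m

  ΣĒ-update : ∀ {f g c u v} → (u , v) ∈Ē A →
    (∀ a b → a ≢ u ⊎ b ≢ v → g a b ≡ f a b) → g u v ≡ f u v + c → ΣĒ A g ≡ ΣĒ A f + c
  ΣĒ-update {f} {g} {c} {u} {v} uv∈Ē elsewhere at-uv =
    Σ-update u
      (λ a a≢u → Σ-cong λ b → onĒ-lift _≡_ g f a b refl (λ _ → elsewhere a b (inj₁ a≢u)))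
      (Σ-update v (λ b b≢v → onĒ-lift _≡_ g f u b refl (λ _ → elsewhere u b (inj₂ b≢v)))
        (begin
          onĒ g u v       ≡⟨ onĒ-edge {g} uv∈Ē ⟩
          g u v           ≡⟨ at-uv ⟩
          f u v + c       ≡⟨ cong (_+ c) (onĒ-edge {f} uv∈Ē) ⟨
          onĒ f u v + c   ∎))
    where open ≡-Reasoning

-- walk A is the paper's P = A D⁻¹, and IsPPR A α s π says exactly 𝓛 A α π ≡ α e_s.
walk : ∀ {n} → Matrix n → (Fin n → ℚ) → Fin n → ℚ
walk {n} A x u = Σ[ n ] (λ v → (A u v ÷ᵗ deg A v) * x v)

𝓛 : ∀ {n} → Matrix n → ℚ → (Fin n → ℚ) → Fin n → ℚ
𝓛 A α x u = x u - (1ℚ - α) * walk A x u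

module _ {n : ℕ} (A : Matrix n) where

  walk-sub : ∀ x y u → walk A (λ w → x w - y w) u ≡ walk A x u - walk A y u
  walk-sub x y u = trans
    (Σ-cong (λ v → *-distribˡ-sub (A u v ÷ᵗ deg A v) (x v) (y v)))
    (Σ-distrib-sub (λ v → (A u v ÷ᵗ deg A v) * x v) (λ v → (A u v ÷ᵗ deg A v) * y v))
    where
    *-distribˡ-sub : ∀ a p q → a * (p - q) ≡ a * p - a * q
    *-distribˡ-sub = solve-∀ ℚ-ring

  walk-scale : ∀ c x u → walk A (λ w → c * x w) u ≡ c * walk A x u
  walk-scale c x u = trans
    (Σ-cong (λ v → x*yz≡y*xz (A u v ÷ᵗ deg A v) c (x v)))
    (sym (*-distribˡ-Σ c (λ v → (A u v ÷ᵗ deg A v) * x v)))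

  walk-Σ : ∀ {m} (c : Fin m → ℚ) (x : Fin m → Fin n → ℚ) u →
    walk A (λ w → Σ[ m ] (λ s → c s * x s w)) u ≡ Σ[ m ] (λ s → c s * walk A (x s) u)
  walk-Σ {m} c x u = begin
    Σ[ n ] (λ v → P v * Σ[ m ] (λ s → c s * x s v))
      ≡⟨ Σ-cong (λ v → *-distribˡ-Σ (P v) (λ s → c s * x s v)) ⟩
    Σ[ n ] (λ v → Σ[ m ] (λ s → P v * (c s * x s v)))
      ≡⟨ Σ-cong (λ v → Σ-cong (λ s → x*yz≡y*xz (P v) (c s) (x s v))) ⟩
    Σ[ n ] (λ v → Σ[ m ] (λ s → c s * (P v * x s v)))
      ≡⟨ Σ-comm (λ v s → c s * (P v * x s v)) ⟩
    Σ[ m ] (λ s → Σ[ n ] (λ v → c s * (P v * x s v)))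
      ≡⟨ Σ-cong (λ s → *-distribˡ-Σ (c s) (λ v → P v * x s v)) ⟨
    Σ[ m ] (λ s → c s * walk A (x s) u)
      ∎
    where
    open ≡-Reasoning
    P : Fin n → ℚ
    P v = A u v ÷ᵗ deg A v

  walk-deg : (∀ v → deg A v ≢ 0ℚ) → ∀ u → walk A (deg A) u ≡ deg A u
  walk-deg d≢0 u = Σ-cong λ v → begin
    (A u v ÷ᵗ deg A v) * deg A v   ≡⟨ *-comm _ (deg A v) ⟩
    deg A v * (A u v ÷ᵗ deg A v)   ≡⟨ *-÷ᵗ-cancel (A u v) (d≢0 v) ⟩
    A u v                          ∎
    where open ≡-Reasoning

  module _ (α : ℚ) where

    𝓛-sub : ∀ x y u → 𝓛 A α (λ w → x w - y w) u ≡ 𝓛 A α x u - 𝓛 A α y u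
    𝓛-sub x y u = trans
      (cong (λ W → x u - y u - (1ℚ - α) * W) (walk-sub x y u))
      (regroup (x u) (y u) (1ℚ - α) (walk A x u) (walk A y u))
      where
      regroup : ∀ p q b P Q → p - q - b * (P - Q) ≡ (p - b * P) - (q - b * Q)
      regroup = solve-∀ ℚ-ring

    𝓛-scale : ∀ c x u → 𝓛 A α (λ w → c * x w) u ≡ c * 𝓛 A α x u
    𝓛-scale c x u = trans
      (cong (λ W → c * x u - (1ℚ - α) * W) (walk-scale c x u))
      (regroup c (x u) (1ℚ - α) (walk A x u))
      where
      regroup : ∀ c p b P → c * p - b * (c * P) ≡ c * (p - b * P)
      regroup = solve-∀ ℚ-ring

    𝓛-Σ : ∀ {m} (c : Fin m → ℚ) (x : Fin m → Fin n → ℚ) u →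
      𝓛 A α (λ w → Σ[ m ] (λ s → c s * x s w)) u ≡ Σ[ m ] (λ s → c s * 𝓛 A α (x s) u)
    𝓛-Σ {m} c x u = begin
      Σ[ m ] cx - β * walk A (λ w → Σ[ m ] (λ s → c s * x s w)) u
        ≡⟨ cong (λ W → Σ[ m ] cx - β * W) (walk-Σ c x u) ⟩
      Σ[ m ] cx - β * Σ[ m ] cW
        ≡⟨ cong (λ W → Σ[ m ] cx - W) (*-distribˡ-Σ β cW) ⟩
      Σ[ m ] cx - Σ[ m ] (λ s → β * cW s)
        ≡⟨ Σ-distrib-sub cx (λ s → β * cW s) ⟨
      Σ[ m ] (λ s → cx s - β * cW s)
        ≡⟨ Σ-cong (λ s → regroup (c s) (x s u) β (walk A (x s) u)) ⟩
      Σ[ m ] (λ s → c s * 𝓛 A α (x s) u)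
        ∎
      where
      open ≡-Reasoning
      β = 1ℚ - α
      cx cW : Fin m → ℚ
      cx s = c s * x s u
      cW s = c s * walk A (x s) u
      regroup : ∀ c p b P → c * p - b * (c * P) ≡ c * (p - b * P)
      regroup = solve-∀ ℚ-ring

    𝓛-deg : (∀ v → deg A v ≢ 0ℚ) → ∀ u → 𝓛 A α (deg A) u ≡ α * deg A u
    𝓛-deg d≢0 u = trans
      (cong (λ W → deg A u - (1ℚ - α) * W) (walk-deg d≢0 u))
      (d-[1-a]d≡ad α (deg A u))
      where
      d-[1-a]d≡ad : ∀ a d → d - (1ℚ - a) * d ≡ a * d
      d-[1-a]d≡ad = solve-∀ ℚ-ring

module _ {n : ℕ} {A : Matrix n} (A≥0 : ∀ u v → 0ℚ ≤ A u v) (d>0 : ∀ u → 0ℚ < deg A u) where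

  private
    d≢0 : ∀ u → deg A u ≢ 0ℚ
    d≢0 u = 0<p⇒p≢0 (d>0 u)

  walk-≥-at-min : ∀ x m → (∀ u → x m ÷ᵗ deg A m ≤ x u ÷ᵗ deg A u) → x m ≤ walk A x m
  walk-≥-at-min x m minimal = begin
    x m                           ≡⟨ *-÷ᵗ-cancel (x m) (d≢0 m) ⟨
    deg A m * r m                 ≡⟨ *-comm (deg A m) (r m) ⟩
    r m * Σ[ n ] (A m)            ≡⟨ *-distribˡ-Σ (r m) (A m) ⟩
    Σ[ n ] (λ u → r m * A m u)    ≤⟨ Σ-mono-≤ (λ u → *-monoʳ-≤-nonNeg′ (A≥0 m u) (minimal u)) ⟩
    Σ[ n ] (λ u → r u * A m u)    ≡⟨ Σ-cong (λ u → trans (÷ᵗ-*≡*-÷ᵗ (x u) (A m u) (deg A u))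
                                                         (*-comm (x u) _)) ⟩
    walk A x m                    ∎
    where
    open ≤-Reasoning
    r : Fin n → ℚ
    r u = x u ÷ᵗ deg A u

  -- At a minimiser m of x/deg, 0 ≤ 𝓛 x m ≤ x m - (1-α) x m = α x m, so min (x/deg) ≥ 0.
  𝓛-nonNeg⇒nonNeg : ∀ {α} → 0ℚ < α → α ≤ 1ℚ →
    ∀ x → (∀ u → 0ℚ ≤ 𝓛 A α x u) → ∀ u → 0ℚ ≤ x u
  𝓛-nonNeg⇒nonNeg {α} 0<α α≤1 x 0≤𝓛x u = subst (0ℚ ≤_) (*-÷ᵗ-cancel (x u) (d≢0 u))
    (*-nonNeg (<⇒≤ (d>0 u)) (≤-trans 0≤r[m] (minimal u)))
    where
    r : Fin n → ℚ
    r v = x v ÷ᵗ deg A v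
    m : Fin n
    m = argmin r u (allFin n)
    minimal : ∀ v → r m ≤ r v
    minimal v = All.lookup (f[argmin]≤f[xs] u (allFin n)) (∈-allFin v)
    0≤αx[m] : 0ℚ ≤ α * x m
    0≤αx[m] = begin
      0ℚ                            ≤⟨ 0≤𝓛x m ⟩
      x m - (1ℚ - α) * walk A x m   ≤⟨ +-monoʳ-≤ (x m) (neg-antimono-≤ (*-monoˡ-≤-nonNeg′
                                         (p≤q⇒0≤q-p α≤1) (walk-≥-at-min x m minimal))) ⟩
      x m - (1ℚ - α) * x m          ≡⟨ p-[1-a]p≡ap α (x m) ⟩
      α * x m                       ∎
      where
      open ≤-Reasoning
      p-[1-a]p≡ap : ∀ a p → p - (1ℚ - a) * p ≡ a * p
      p-[1-a]p≡ap = solve-∀ ℚ-ring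
    0≤r[m] : 0ℚ ≤ r m
    0≤r[m] = ÷ᵗ-nonNeg (*-cancelˡ-≤-pos α {{positive 0<α}}
      (subst (_≤ α * x m) (sym (*-zeroʳ α)) 0≤αx[m])) (<⇒≤ (d>0 m))

  -- Both deg A and z solve 𝓛 x = α deg A, so the minimum principle applies to deg A - z.
  Σ[deg*ppr]≤deg : ∀ {α} → 0ℚ < α → α ≤ 1ℚ →
    (πs : Fin n → Fin n → ℚ) → (∀ s → IsPPR A α s (πs s)) →
    ∀ u → Σ[ n ] (λ s → deg A s * πs s u) ≤ deg A u
  Σ[deg*ppr]≤deg {α} 0<α α≤1 πs ppr u = 0≤q-p⇒p≤q
    (𝓛-nonNeg⇒nonNeg 0<α α≤1 (λ w → deg A w - z w) (≤-reflexive ∘ sym ∘ 𝓛[d-z]≡0) u)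
    where
    z : Fin n → ℚ
    z w = Σ[ n ] (λ s → deg A s * πs s w)
    𝓛[d-z]≡0 : ∀ v → 𝓛 A α (λ w → deg A w - z w) v ≡ 0ℚ
    𝓛[d-z]≡0 v = begin
      𝓛 A α (λ w → deg A w - z w) v
        ≡⟨ 𝓛-sub A α (deg A) z v ⟩
      𝓛 A α (deg A) v - 𝓛 A α z v
        ≡⟨ cong₂ _-_ (𝓛-deg A α d≢0 v) (𝓛-Σ A α (deg A) πs v) ⟩
      α * deg A v - Σ[ n ] (λ s → deg A s * 𝓛 A α (πs s) v)
        ≡⟨ cong (λ S → α * deg A v - S) (Σ-cong (λ s → cong (deg A s *_) (ppr s v))) ⟩
      α * deg A v - Σ[ n ] (λ s → deg A s * (α * 𝟙[ s ≡ v ]))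
        ≡⟨ cong (λ S → α * deg A v - S) (Σ-cong (λ s → x*yz≡y*xz (deg A s) α 𝟙[ s ≡ v ])) ⟩
      α * deg A v - Σ[ n ] (λ s → α * (deg A s * 𝟙[ s ≡ v ]))
        ≡⟨ cong (λ S → α * deg A v - S) (*-distribˡ-Σ α (λ s → deg A s * 𝟙[ s ≡ v ])) ⟨
      α * deg A v - α * Σ[ n ] (λ s → deg A s * 𝟙[ s ≡ v ])
        ≡⟨ cong (λ S → α * deg A v - α * S) (Σ-indicator (deg A) v) ⟩
      α * deg A v - α * deg A v
        ≡⟨ +-inverseʳ (α * deg A v) ⟩
      0ℚ
        ∎
      where open ≡-Reasoning

share : ∀ {n} → Matrix n → ℚ → ℚ → Fin n → Fin n → ℚ
share A α x u v = ((1ℚ - α) * x * A u v) ÷ᵗ deg A u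

module _ {n : ℕ} (A : Matrix n) (α : ℚ) (st : State n) (u v : Fin n) where

  push-income-target : q (push A α st u v) v ≡ q st v + residue A α st u v
  push-income-target with v ≟ᶠ v
  ... | yes _   = refl
  ... | no v≢v = ⊥-elim (v≢v refl)

  push-income-other : ∀ {w} → w ≢ v → q (push A α st u v) w ≡ q st w
  push-income-other {w} w≢v with w ≟ᶠ v
  ... | yes w≡v = ⊥-elim (w≢v w≡v)
  ... | no _    = refl

  push-expense-edge : Q (push A α st u v) u v ≡ Q st u v + residue A α st u v
  push-expense-edge with u ≟ᶠ u | v ≟ᶠ v
  ... | yes _   | yes _   = refl
  ... | yes _   | no v≢v = ⊥-elim (v≢v refl)
  ... | no u≢u | _       = ⊥-elim (u≢u refl)

  push-expense-other : ∀ {a b} → a ≢ u ⊎ b ≢ v → Q (push A α st u v) a b ≡ Q st a b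
  push-expense-other {a} {b} a≢u⊎b≢v with a ≟ᶠ u | b ≟ᶠ v | a≢u⊎b≢v
  ... | no _     | _        | _          = refl
  ... | yes _    | no _     | _          = refl
  ... | yes a≡u | yes _    | inj₁ a≢u = ⊥-elim (a≢u a≡u)
  ... | yes _    | yes b≡v | inj₂ b≢v = ⊥-elim (b≢v b≡v)

record Invariant {n : ℕ} (A : Matrix n) (α : ℚ) (s : Fin n) (st : State n) : Set where
  field
    expense≤share : ∀ u v → Q st u v ≤ share A α (q st u) u v
    income≡       : ∀ v → q st v ≡ 𝟙[ s ≡ v ] + Σ[ n ] (λ u → Q st u v)

module _ {n : ℕ} {A : Matrix n} (A≥0 : ∀ u v → 0ℚ ≤ A u v) {α : ℚ} (α≤1 : α ≤ 1ℚ) where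

  share-mono-≤ : ∀ {x y} u v → x ≤ y → share A α x u v ≤ share A α y u v
  share-mono-≤ u v x≤y = ÷ᵗ-monoˡ-≤ (Σ-nonNeg (A≥0 u))
    (*-monoʳ-≤-nonNeg′ (A≥0 u v) (*-monoˡ-≤-nonNeg′ (p≤q⇒0≤q-p α≤1) x≤y))

  share-nonNeg : ∀ {x} u v → 0ℚ ≤ x → 0ℚ ≤ share A α x u v
  share-nonNeg u v 0≤x =
    ÷ᵗ-nonNeg (*-nonNeg (*-nonNeg (p≤q⇒0≤q-p α≤1) 0≤x) (A≥0 u v)) (Σ-nonNeg (A≥0 u))

  init-invariant : ∀ s → Invariant A α s (initState s)
  init-invariant s = record
    { expense≤share = λ u v → share-nonNeg u v (𝟙-nonNeg s u)
    ; income≡       = λ v → sym (trans (cong (𝟙[ s ≡ v ] +_) (Σ-0 n)) (+-identityʳ _))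
    }

  push-invariant : ∀ {s st u v} → Invariant A α s st → 0ℚ ≤ residue A α st u v →
    Invariant A α s (push A α st u v)
  push-invariant {s} {st} {u} {v} inv 0≤y = record
    { expense≤share = expense≤share′ ; income≡ = income≡′ }
    where
    open Invariant inv
    st′ = push A α st u v
    y   = residue A α st u v

    income-grows : ∀ w → q st w ≤ q st′ w
    income-grows w with w ≟ᶠ v
    ... | yes _ = subst (_≤ q st w + y) (+-identityʳ (q st w)) (+-monoʳ-≤ (q st w) 0≤y)
    ... | no _  = ≤-refl

    expense≤share′ : ∀ a b → Q st′ a b ≤ share A α (q st′ a) a b
    expense≤share′ a b = by-cases (a ≟ᶠ u) (b ≟ᶠ v)
      where
      unchanged : a ≢ u ⊎ b ≢ v → Q st′ a b ≤ share A α (q st′ a) a b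
      unchanged off-edge = subst (_≤ share A α (q st′ a) a b)
        (sym (push-expense-other A α st u v off-edge))
        (≤-trans (expense≤share a b) (share-mono-≤ a b (income-grows a)))

      by-cases : Dec (a ≡ u) → Dec (b ≡ v) → Q st′ a b ≤ share A α (q st′ a) a b
      by-cases (yes refl) (yes refl) = begin
        Q st′ u v                  ≡⟨ push-expense-edge A α st u v ⟩
        Q st u v + y               ≡⟨ p+[q-p]≡q (Q st u v) (share A α (q st u) u v) ⟩
        share A α (q st u) u v     ≤⟨ share-mono-≤ u v (income-grows u) ⟩
        share A α (q st′ u) u v    ∎
        where
        open ≤-Reasoning
        p+[q-p]≡q : ∀ p q → p + (q - p) ≡ q
        p+[q-p]≡q = solve-∀ ℚ-ring
      by-cases (no a≢u) _         = unchanged (inj₁ a≢u)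
      by-cases (yes _)  (no b≢v) = unchanged (inj₂ b≢v)

    income≡′ : ∀ w → q st′ w ≡ 𝟙[ s ≡ w ] + Σ[ n ] (λ a → Q st′ a w)
    income≡′ w = by-cases (w ≟ᶠ v)
      where
      by-cases : Dec (w ≡ v) → q st′ w ≡ 𝟙[ s ≡ w ] + Σ[ n ] (λ a → Q st′ a w)
      by-cases (yes refl) = begin
        q st′ v                                    ≡⟨ push-income-target A α st u v ⟩
        q st v + y                                 ≡⟨ cong (_+ y) (income≡ v) ⟩
        𝟙[ s ≡ v ] + Σ[ n ] (λ a → Q st a v) + y   ≡⟨ +-assoc 𝟙[ s ≡ v ] _ y ⟩
        𝟙[ s ≡ v ] + (Σ[ n ] (λ a → Q st a v) + y)
          ≡⟨ cong (𝟙[ s ≡ v ] +_) (Σ-update u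
               (λ a a≢u → push-expense-other A α st u v (inj₁ a≢u)) (push-expense-edge A α st u v)) ⟨
        𝟙[ s ≡ v ] + Σ[ n ] (λ a → Q st′ a v)      ∎
        where open ≡-Reasoning
      by-cases (no w≢v) = begin
        q st′ w                                 ≡⟨ push-income-other A α st u v w≢v ⟩
        q st w                                  ≡⟨ income≡ w ⟩
        𝟙[ s ≡ w ] + Σ[ n ] (λ a → Q st a w)
          ≡⟨ cong (𝟙[ s ≡ w ] +_)
               (Σ-cong (λ a → push-expense-other A α st u v {a} (inj₂ w≢v))) ⟨
        𝟙[ s ≡ w ] + Σ[ n ] (λ a → Q st′ a w)   ∎
        where open ≡-Reasoning

module _ {n : ℕ} {A : Matrix n} {α : ℚ} {θ : Matrix n} {s : Fin n}
         (θ>0 : ∀ u v → (u , v) ∈Ē A → 0ℚ < θ u v) where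

  run-invariant : (∀ u v → 0ℚ ≤ A u v) → α ≤ 1ℚ →
    ∀ {k st} → Run A α θ s k st → Invariant A α s st
  run-invariant A≥0 α≤1 start = init-invariant A≥0 α≤1 s
  run-invariant A≥0 α≤1 (next run (step _ u v uv∈Ē θ≤y)) =
    push-invariant A≥0 α≤1 (run-invariant A≥0 α≤1 run) (≤-trans (<⇒≤ (θ>0 u v uv∈Ē)) θ≤y)

  pushes≤ΣĒ : ∀ {k st} → Run A α θ s k st → ℕ→ℚ k ≤ ΣĒ A (λ u v → Q st u v ÷ᵗ θ u v)
  pushes≤ΣĒ start = ΣĒ-nonNeg (λ u v uv∈Ē → ÷ᵗ-nonNeg ≤-refl (<⇒≤ (θ>0 u v uv∈Ē)))
  pushes≤ΣĒ {suc k} (next {st = st} run (step _ u v uv∈Ē θ≤y)) = begin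
    ℕ→ℚ (suc k)                                     ≡⟨ ℕ→ℚ-suc k ⟩
    ℕ→ℚ k + 1ℚ                                      ≤⟨ +-mono-≤ (pushes≤ΣĒ run) 1≤y÷θ ⟩
    ΣĒ A (λ a b → Q st a b ÷ᵗ θ a b) + y ÷ᵗ θ u v   ≡⟨ ΣĒ-update uv∈Ē off-edge on-edge ⟨
    ΣĒ A (λ a b → Q st′ a b ÷ᵗ θ a b)               ∎
    where
    open ≤-Reasoning
    st′ = push A α st u v
    y   = residue A α st u v
    1≤y÷θ : 1ℚ ≤ y ÷ᵗ θ u v
    1≤y÷θ = ≤-÷ᵗ (θ>0 u v uv∈Ē) (subst (_≤ y) (sym (*-identityʳ (θ u v))) θ≤y)
    off-edge : ∀ a b → a ≢ u ⊎ b ≢ v → Q st′ a b ÷ᵗ θ a b ≡ Q st a b ÷ᵗ θ a b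
    off-edge a b off = cong (_÷ᵗ θ a b) (push-expense-other A α st u v off)
    on-edge : Q st′ u v ÷ᵗ θ u v ≡ Q st u v ÷ᵗ θ u v + y ÷ᵗ θ u v
    on-edge = trans (cong (_÷ᵗ θ u v) (push-expense-edge A α st u v))
                    (÷ᵗ-distribʳ-+ (Q st u v) y (θ u v))

module _ {n : ℕ} {A : Matrix n} (G : ValidGraph A) {α : ℚ} (0<α : 0ℚ < α) (α≤1 : α ≤ 1ℚ)
         {θ : Matrix n} (θ>0 : ∀ u v → (u , v) ∈Ē A → 0ℚ < θ u v) where
  open ValidGraph G

  share-transpose : ∀ x u v → share A α x u v ≡ (1ℚ - α) * ((A v u ÷ᵗ deg A u) * x)
  share-transpose x u v = begin
    ((1ℚ - α) * x * A u v) ÷ᵗ deg A u     ≡⟨ cong (λ a → ((1ℚ - α) * x * a) ÷ᵗ deg A u) (symm u v) ⟩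
    ((1ℚ - α) * x * A v u) ÷ᵗ deg A u     ≡⟨ *-÷ᵗ-assoc ((1ℚ - α) * x) (A v u) (deg A u) ⟩
    (1ℚ - α) * x * (A v u ÷ᵗ deg A u)     ≡⟨ xy*z≡x*zy (1ℚ - α) x (A v u ÷ᵗ deg A u) ⟩
    (1ℚ - α) * ((A v u ÷ᵗ deg A u) * x)   ∎
    where
    open ≡-Reasoning
    xy*z≡x*zy : ∀ p q r → p * q * r ≡ p * (r * q)
    xy*z≡x*zy = solve-∀ ℚ-ring

  Σ-expense≤walk : ∀ {s st} → Invariant A α s st → ∀ v →
    Σ[ n ] (λ u → Q st u v) ≤ (1ℚ - α) * walk A (q st) v
  Σ-expense≤walk {st = st} inv v = begin
    Σ[ n ] (λ u → Q st u v)
      ≤⟨ Σ-mono-≤ (λ u → Invariant.expense≤share inv u v) ⟩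
    Σ[ n ] (λ u → share A α (q st u) u v)
      ≡⟨ Σ-cong (λ u → share-transpose (q st u) u v) ⟩
    Σ[ n ] (λ u → (1ℚ - α) * ((A v u ÷ᵗ deg A u) * q st u))
      ≡⟨ *-distribˡ-Σ (1ℚ - α) (λ u → (A v u ÷ᵗ deg A u) * q st u) ⟨
    (1ℚ - α) * walk A (q st) v
      ∎
    where open ≤-Reasoning

  0≤𝓛[ppr-αq] : ∀ {s st π} → IsPPR A α s π → Invariant A α s st →
    ∀ v → 0ℚ ≤ 𝓛 A α (λ w → π w - α * q st w) v
  0≤𝓛[ppr-αq] {s} {st} {π} ppr inv v = subst (0ℚ ≤_) (sym 𝓛[ppr-αq]≡)
    (*-nonNeg (<⇒≤ 0<α) (p≤q⇒0≤q-p (Σ-expense≤walk inv v)))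
    where
    open Invariant inv
    S = Σ[ n ] (λ u → Q st u v)
    W = walk A (q st) v
    regroup : ∀ a e S b W → a * e - a * ((e + S) - b * W) ≡ a * (b * W - S)
    regroup = solve-∀ ℚ-ring
    𝓛[ppr-αq]≡ : 𝓛 A α (λ w → π w - α * q st w) v ≡ α * ((1ℚ - α) * W - S)
    𝓛[ppr-αq]≡ = begin
      𝓛 A α (λ w → π w - α * q st w) v
        ≡⟨ 𝓛-sub A α π (λ w → α * q st w) v ⟩
      𝓛 A α π v - 𝓛 A α (λ w → α * q st w) v
        ≡⟨ cong₂ _-_ (ppr v) (𝓛-scale A α α (q st) v) ⟩
      α * 𝟙[ s ≡ v ] - α * (q st v - (1ℚ - α) * W)
        ≡⟨ cong (λ x → α * 𝟙[ s ≡ v ] - α * (x - (1ℚ - α) * W)) (income≡ v) ⟩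
      α * 𝟙[ s ≡ v ] - α * ((𝟙[ s ≡ v ] + S) - (1ℚ - α) * W)
        ≡⟨ regroup α 𝟙[ s ≡ v ] S (1ℚ - α) W ⟩
      α * ((1ℚ - α) * W - S)
        ∎
      where open ≡-Reasoning

  αq≤ppr : ∀ {s st π} → IsPPR A α s π → Invariant A α s st → ∀ u → α * q st u ≤ π u
  αq≤ppr {st = st} {π} ppr inv u = 0≤q-p⇒p≤q (𝓛-nonNeg⇒nonNeg nonneg degpos 0<α α≤1
    (λ w → π w - α * q st w) (0≤𝓛[ppr-αq] {π = π} ppr inv) u)

  expense÷θ≤ : ∀ {s st π u v} → IsPPR A α s π → Invariant A α s st → (u , v) ∈Ē A →
    Q st u v ÷ᵗ θ u v ≤ ((1ℚ - α) * π u * A u v) ÷ᵗ (α * deg A u * θ u v)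
  expense÷θ≤ {st = st} {π} {u} {v} ppr inv uv∈Ē = ≤-÷ᵗ (*-pos (*-pos 0<α (degpos u)) 0<θ) (begin
    α * deg A u * θ u v * (Q st u v ÷ᵗ θ u v)
      ≡⟨ *-assoc (α * deg A u) (θ u v) _ ⟩
    α * deg A u * (θ u v * (Q st u v ÷ᵗ θ u v))
      ≡⟨ cong (α * deg A u *_) (*-÷ᵗ-cancel (Q st u v) (0<p⇒p≢0 0<θ)) ⟩
    α * deg A u * Q st u v
      ≤⟨ *-monoˡ-≤-nonNeg′ (*-nonNeg (<⇒≤ 0<α) (<⇒≤ (degpos u))) (expense≤share u v) ⟩
    α * deg A u * share A α (q st u) u v
      ≡⟨ *-assoc α (deg A u) _ ⟩
    α * (deg A u * share A α (q st u) u v)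
      ≡⟨ cong (α *_) (*-÷ᵗ-cancel _ (0<p⇒p≢0 (degpos u))) ⟩
    α * ((1ℚ - α) * q st u * A u v)
      ≡⟨ regroup α (1ℚ - α) (q st u) (A u v) ⟩
    (1ℚ - α) * (α * q st u) * A u v
      ≤⟨ *-monoʳ-≤-nonNeg′ (nonneg u v)
           (*-monoˡ-≤-nonNeg′ (p≤q⇒0≤q-p α≤1) (αq≤ppr {π = π} ppr inv u)) ⟩
    (1ℚ - α) * π u * A u v
      ∎)
    where
    open ≤-Reasoning
    open Invariant inv
    0<θ = θ>0 u v uv∈Ē
    regroup : ∀ a b x c → a * (b * x * c) ≡ b * (a * x) * c
    regroup = solve-∀ ℚ-ring

  pushes≤ΣĒ[ppr] : ∀ {s π k st} → IsPPR A α s π → Run A α θ s k st →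
    ℕ→ℚ k ≤ ΣĒ A (λ u v → ((1ℚ - α) * π u * A u v) ÷ᵗ (α * deg A u * θ u v))
  pushes≤ΣĒ[ppr] {π = π} ppr run = ≤-trans (pushes≤ΣĒ θ>0 run)
    (ΣĒ-mono-≤ (λ u v → expense÷θ≤ {π = π} {u} {v} ppr (run-invariant θ>0 nonneg α≤1 run)))

  edge-factor : Fin n → Fin n → ℚ
  edge-factor u v = ((1ℚ - α) * A u v) ÷ᵗ (α * deg A u * θ u v)

  ppr-term≡ : ∀ (π : Fin n → ℚ) u v →
    ((1ℚ - α) * π u * A u v) ÷ᵗ (α * deg A u * θ u v) ≡ π u * edge-factor u v
  ppr-term≡ π u v = trans
    (cong (_÷ᵗ (α * deg A u * θ u v)) (xy*z≡y*xz (1ℚ - α) (π u) (A u v)))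
    (*-÷ᵗ-assoc (π u) ((1ℚ - α) * A u v) (α * deg A u * θ u v))
    where
    xy*z≡y*xz : ∀ p q r → p * q * r ≡ q * (p * r)
    xy*z≡y*xz = solve-∀ ℚ-ring

  Σ-weighted-ppr-term≤ : (πs : Fin n → Fin n → ℚ) → (∀ s → IsPPR A α s (πs s)) →
    ∀ u v → (u , v) ∈Ē A →
    Σ[ n ] (λ s → (deg A s ÷ᵗ norm1 A) * (πs s u * edge-factor u v))
      ≤ ((1ℚ - α) * A u v) ÷ᵗ (α * norm1 A * θ u v)
  Σ-weighted-ppr-term≤ πs ppr u v uv∈Ē = ≤-÷ᵗ (*-pos (*-pos 0<α 0<N) 0<θ) (begin
    α * N * θ u v * Σ[ n ] (λ s → c s * (πs s u * w))
      ≡⟨ *-distribˡ-Σ (α * N * θ u v) (λ s → c s * (πs s u * w)) ⟩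
    Σ[ n ] (λ s → α * N * θ u v * (c s * (πs s u * w)))
      ≡⟨ Σ-cong (λ s → regroup α N (θ u v) (c s) (πs s u) w) ⟩
    Σ[ n ] (λ s → α * θ u v * w * (N * c s * πs s u))
      ≡⟨ Σ-cong (λ s → cong (λ d → α * θ u v * w * (d * πs s u))
                             (*-÷ᵗ-cancel (deg A s) N≢0)) ⟩
    Σ[ n ] (λ s → α * θ u v * w * (deg A s * πs s u))
      ≡⟨ *-distribˡ-Σ (α * θ u v * w) (λ s → deg A s * πs s u) ⟨
    α * θ u v * w * Σ[ n ] (λ s → deg A s * πs s u)
      ≤⟨ *-monoˡ-≤-nonNeg′ 0≤αθw (Σ[deg*ppr]≤deg nonneg degpos 0<α α≤1 πs ppr u) ⟩
    α * θ u v * w * deg A u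
      ≡⟨ regroup′ α (θ u v) w (deg A u) ⟩
    α * deg A u * θ u v * w
      ≡⟨ *-÷ᵗ-cancel ((1ℚ - α) * A u v) (0<p⇒p≢0 0<αdθ) ⟩
    (1ℚ - α) * A u v
      ∎)
    where
    open ≤-Reasoning
    N = norm1 A
    0<N : 0ℚ < N
    0<N = norm1-pos degpos u
    N≢0 : N ≢ 0ℚ
    N≢0 = 0<p⇒p≢0 0<N
    c : Fin n → ℚ
    c s = deg A s ÷ᵗ N
    w = edge-factor u v
    0<θ = θ>0 u v uv∈Ē
    0<αdθ : 0ℚ < α * deg A u * θ u v
    0<αdθ = *-pos (*-pos 0<α (degpos u)) 0<θ
    0≤αθw : 0ℚ ≤ α * θ u v * w
    0≤αθw = *-nonNeg (*-nonNeg (<⇒≤ 0<α) (<⇒≤ 0<θ))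
      (÷ᵗ-nonNeg (*-nonNeg (p≤q⇒0≤q-p α≤1) (nonneg u v)) (<⇒≤ 0<αdθ))
    regroup : ∀ a N t c p w → a * N * t * (c * (p * w)) ≡ a * t * w * (N * c * p)
    regroup = solve-∀ ℚ-ring
    regroup′ : ∀ a t w d → a * t * w * d ≡ a * d * t * w
    regroup′ = solve-∀ ℚ-ring

  degree-weighted-pushes≤ : (πs : Fin n → Fin n → ℚ) → (∀ s → IsPPR A α s (πs s)) →
    (ks : Fin n → ℕ) → (∀ s → ∃ λ st → Run A α θ s (ks s) st) →
    Σ[ n ] (λ s → (deg A s ÷ᵗ norm1 A) * ℕ→ℚ (ks s))
      ≤ ΣĒ A (λ u v → ((1ℚ - α) * A u v) ÷ᵗ (α * norm1 A * θ u v))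
  degree-weighted-pushes≤ πs ppr ks runs = begin
    Σ[ n ] (λ s → c s * ℕ→ℚ (ks s))
      ≤⟨ Σ-mono-≤ (λ s → *-monoˡ-≤-nonNeg′ (0≤c s) (pushes[s]≤ s)) ⟩
    Σ[ n ] (λ s → c s * ΣĒ A (λ u v → πs s u * edge-factor u v))
      ≡⟨ Σ-cong (λ s → *-distribˡ-ΣĒ (c s) (λ u v → πs s u * edge-factor u v)) ⟩
    Σ[ n ] (λ s → ΣĒ A (λ u v → c s * (πs s u * edge-factor u v)))
      ≡⟨ Σ-ΣĒ-comm (λ s u v → c s * (πs s u * edge-factor u v)) ⟩
    ΣĒ A (λ u v → Σ[ n ] (λ s → c s * (πs s u * edge-factor u v)))
      ≤⟨ ΣĒ-mono-≤ (Σ-weighted-ppr-term≤ πs ppr) ⟩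
    ΣĒ A (λ u v → ((1ℚ - α) * A u v) ÷ᵗ (α * norm1 A * θ u v))
      ∎
    where
    open ≤-Reasoning
    c : Fin n → ℚ
    c s = deg A s ÷ᵗ norm1 A
    0≤c : ∀ s → 0ℚ ≤ c s
    0≤c s = ÷ᵗ-nonNeg (<⇒≤ (degpos s)) (<⇒≤ (norm1-pos degpos s))
    pushes[s]≤ : ∀ s → ℕ→ℚ (ks s) ≤ ΣĒ A (λ u v → πs s u * edge-factor u v)
    pushes[s]≤ s = ≤-trans (pushes≤ΣĒ[ppr] {π = πs s} (ppr s) (proj₂ (runs s)))
      (ΣĒ-mono-≤ (λ u v _ → ≤-reflexive (ppr-term≡ (πs s) u v)))

lemma5p1 : Σ ℚ λ C →
    ∀ (n : ℕ) (A : Matrix n) → ValidGraph A →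
    ∀ (α : ℚ) → 0ℚ < α → α < 1ℚ →
    ∀ (θ : Matrix n) → (∀ u v → (u , v) ∈Ē A → 0ℚ < θ u v) →
      (∀ (s : Fin n) (π : Fin n → ℚ) → IsPPR A α s π →
         ∀ (k : ℕ) (st : State n) → Run A α θ s k st →
           ℕ→ℚ k ≤ C * ΣĒ A (λ u v →
             ((1ℚ - α) * π u * A u v) ÷ᵗ (α * deg A u * θ u v)))
      ×
      (∀ (πs : Fin n → Fin n → ℚ) → (∀ s → IsPPR A α s (πs s)) →
         ∀ (ks : Fin n → ℕ) → (∀ s → ∃ λ st → Run A α θ s (ks s) st) →
           Σ[ n ] (λ s → (deg A s ÷ᵗ norm1 A) * ℕ→ℚ (ks s))
             ≤ C * ΣĒ A (λ u v →
               ((1ℚ - α) * A u v) ÷ᵗ (α * norm1 A * θ u v)))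
lemma5p1 = 1ℚ , λ n A G α 0<α α<1 θ θ>0 →
    (λ s π ppr k st run → times-one (pushes≤ΣĒ[ppr] G 0<α (<⇒≤ α<1) θ>0 {π = π} ppr run))
  , (λ πs ppr ks runs → times-one (degree-weighted-pushes≤ G 0<α (<⇒≤ α<1) θ>0 πs ppr ks runs))
  where
  times-one : ∀ {p q} → p ≤ q → p ≤ 1ℚ * q
  times-one {q = q} p≤q = subst (_ ≤_) (sym (*-identityˡ q)) p≤q
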